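{- If $T$ is a monochromatic tree of order $n\ge 2$, then $pc'_{opt}(T)=n-1-\alpha'(T)$.
   Context: $\alpha'(T)$ denotes the size of a maximum matching of $T$. An edge-colored graph is properly colored if no two adjacent edges share a color; an edge-colored connected graph is properly connected if between every pair of distinct vertices there is a properly colored path. A monochromatic graph is one in which every edge has color $0$. For a monochromatic connected graph $G$, $pc'_{opt}(G)$ is the minimum number $p$ such that $G$ can be made properly connected by recoloring $p$ edges of $G$ (with any colors different from $0$, the number of colors used being unrestricted). -}

module Defs where

open import Data.Nat using (ℕ; zero; suc; _≤_; _≡ᵇ_; _<ᵇ_)
open import Data.Fin using (Fin; toℕ)
open import Data.Bool using (Bool; true; false; T; if_then_else_; _∧_; not)
open import Data.Nat.ListAction using (sum)
open import Data.Empty using (⊥)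
open import Data.List using (List; []; _∷_; _++_; map; allFin; length; concatMap)
open import Data.List.Relation.Unary.Unique.Propositional using (Unique)
open import Data.List.Relation.Unary.All using (All)
open import Data.Product using (Σ; _×_; _,_; ∃)
open import Data.Unit using (⊤)
open import Relation.Binary.PropositionalEquality using (_≡_; _≢_)
open import Relation.Nullary using (¬_)

record Graph (n : ℕ) : Set where
  field
    adj    : Fin n → Fin n → Bool
    sym    : ∀ u v → adj u v ≡ adj v u
    irrefl : ∀ u → adj u u ≡ false
open Graph public

module _ {n : ℕ} (G : Graph n) where

  Adj : Fin n → Fin n → Set
  Adj u v = T (adj G u v)

  AdjChain : List (Fin n) → Set
  AdjChain []            = ⊤
  AdjChain (x ∷ [])      = ⊤
  AdjChain (x ∷ y ∷ r)   = Adj x y × AdjChain (y ∷ r)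

  IsPath : Fin n → Fin n → List (Fin n) → Set
  IsPath x y mid = Unique (x ∷ mid ++ y ∷ []) × AdjChain (x ∷ mid ++ y ∷ [])

  Connected : Set
  Connected = ∀ x y → x ≢ y → ∃ λ mid → IsPath x y mid

  IsCycle : List (Fin n) → Set
  IsCycle []                   = ⊥
  IsCycle (_ ∷ [])             = ⊥
  IsCycle (_ ∷ _ ∷ [])         = ⊥
  IsCycle (v₀ ∷ v₁ ∷ v₂ ∷ r)   =
    Unique (v₀ ∷ v₁ ∷ v₂ ∷ r) × AdjChain ((v₀ ∷ v₁ ∷ v₂ ∷ r) ++ v₀ ∷ [])

  Acyclic : Set
  Acyclic = ∀ L → ¬ IsCycle L

  IsTree : Set
  IsTree = Connected × Acyclic

  endpoints : List (Fin n × Fin n) → List (Fin n)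
  endpoints = concatMap (λ { (u , v) → u ∷ v ∷ [] })

  IsMatching : List (Fin n × Fin n) → Set
  IsMatching M = All (λ { (u , v) → Adj u v }) M × Unique (endpoints M)

  IsMaxMatchingSize : ℕ → Set
  IsMaxMatchingSize k =
    (∃ λ M → IsMatching M × length M ≡ k) ×
    (∀ M → IsMatching M → length M ≤ k)

  -- edge colourings: colour of edge uv is c u v (required symmetric);
  -- colour 0 is the original monochromatic colour
  Coloring : Set
  Coloring = Σ (Fin n → Fin n → ℕ) λ c → ∀ u v → c u v ≡ c v u

  ProperChain : (Fin n → Fin n → ℕ) → List (Fin n) → Set
  ProperChain c (x ∷ y ∷ z ∷ r) = c x y ≢ c y z × ProperChain c (y ∷ z ∷ r)
  ProperChain c _               = ⊤

  ProperlyConnected : Coloring → Set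
  ProperlyConnected (c , _) =
    ∀ x y → x ≢ y → ∃ λ mid → IsPath x y mid × ProperChain c (x ∷ mid ++ y ∷ [])

  recolored : Coloring → ℕ
  recolored (c , _) =
    sum (map (λ u → sum (map (λ v →
      if (toℕ u <ᵇ toℕ v) ∧ adj G u v ∧ not (c u v ≡ᵇ 0) then 1 else 0)
      (allFin n))) (allFin n))

  IsPcOpt : ℕ → Set
  IsPcOpt p =
    (∃ λ c → ProperlyConnected c × recolored c ≡ p) ×
    (∀ c → ProperlyConnected c → p ≤ recolored c)

-- Both sides are compared with the number of edges of T, which is n − 1.  Every colouring
-- splits the edges into those keeping colour 0 and the recoloured ones.
--
-- Upper bound (any connected graph): keep a maximum matching M with colour 0 and give every
-- other edge uv the colour 1 + u + v.  Then any two edges meeting in one vertex get different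
-- colours ("locally proper"), so every path is properly coloured; exactly the edges outside M
-- are recoloured.
--
-- Lower bound (any acyclic graph): in a forest all paths from x to y leave x through the same
-- neighbour, so a properly coloured path from x to z through a common neighbour y must begin
-- with xy, yz; hence a properly connected colouring is locally proper.  In particular no two
-- edges of colour 0 meet, i.e. the kept edges form a matching, of size at most α'(T).
module Submission where

open import Defs renaming (sym to adj-sym)
open import Data.Nat using (ℕ; zero; suc; _+_; _∸_; _≤_; _<_; _<ᵇ_; _≡ᵇ_; z≤n; s≤s)
open import Data.Nat.Properties
  using (≤-trans; ≤-reflexive; <-cmp; <-asym; <⇒<ᵇ; <ᵇ⇒<; ≡ᵇ⇒≡; +-comm; +-cancelˡ-≡; suc-injective;
         m+n∸m≡n; ∸-monoʳ-≤; +-0-commutativeMonoid)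
open import Data.Nat.ListAction using (sum)
open import Algebra.Properties.CommutativeMonoid.Sum +-0-commutativeMonoid
  using (sum-syntax; ∑-distrib-+; ∑-comm; sum-cong-≗; sum-replicate-zero) renaming (sum to ∑)
open import Data.Fin as Fin using (Fin; toℕ) renaming (zero to fzero; suc to fsuc; _≟_ to _≟ᶠ_)
open import Data.Fin.Properties using (toℕ-injective)
open import Data.Bool using (Bool; true; false; T; if_then_else_; _∧_; _∨_; not)
open import Data.Bool.Properties using (∧-zeroʳ; ∧-identityʳ; ∨-comm; T-∧; T-∨)
open import Data.List using (List; []; _∷_; _++_; [_]; map; reverse; length; allFin; tabulate; filter; cartesianProduct)
open import Data.List.Properties using (++-assoc; reverse-++; unfold-reverse; length-reverse; length-++-≤ʳ)
open import Data.List.Relation.Unary.All using (All; []; _∷_)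
import Data.List.Relation.Unary.All as All
open import Data.List.Relation.Unary.All.Properties using (All¬⇒¬Any; ¬Any⇒All¬; ++⁻ˡ; ++⁻ʳ)
open import Data.List.Relation.Unary.Any using (Any; here; there)
import Data.List.Relation.Unary.Any.Properties as Any
open import Data.List.Relation.Unary.AllPairs using ([]; _∷_)
open import Data.List.Relation.Unary.Unique.Propositional using (Unique)
import Data.List.Relation.Unary.Unique.Propositional.Properties as Unique
open import Data.List.Relation.Binary.Permutation.Setoid using (↭-sym)
open import Data.List.Relation.Binary.Permutation.Setoid.Properties using (Unique-resp-↭; ↭-reverse)
open import Data.List.Membership.Propositional using (_∈_; _∉_)
open import Data.List.Membership.Propositional.Properties
  using (∈-∃++; ∈-++⁺ˡ; ∈-++⁺ʳ; ∈-++⁻; ∈-filter⁺; ∈-filter⁻; ∈-allFin; ∈-cartesianProduct⁺)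
open import Data.List.Membership.Setoid.Properties using (reverse⁻)
open import Data.Product using (∃; _×_; _,_; proj₁; proj₂)
open import Data.Product.Properties using (≡-dec)
open import Data.Sum using (_⊎_; inj₁; inj₂; map₁)
open import Data.Unit using (tt)
open import Data.Empty using (⊥; ⊥-elim)
open import Function using (_∘_)
open import Function.Bundles using (Equivalence)
open import Relation.Binary.Definitions using (DecidableEquality; tri<; tri≈; tri>)
open import Relation.Binary.PropositionalEquality
  using (_≡_; _≢_; refl; sym; trans; cong; cong₂; subst; setoid; module ≡-Reasoning)
open import Relation.Nullary using (¬_; Dec; yes; no; does; T?)

module _ {A : Set} where

  -- The vertex following the start of a path  x ∷ mid ++ [ y ].
  next : List A → A → A
  next []      y = y
  next (a ∷ _) _ = a

  next-head : ∀ mid {y w : A} {W} → mid ++ [ y ] ≡ w ∷ W → next mid y ≡ w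
  next-head []      refl = refl
  next-head (_ ∷ _) refl = refl

  next-∷ : ∀ mid (y : A) → ∃ λ rest → mid ++ [ y ] ≡ next mid y ∷ rest
  next-∷ []      y = [] , refl
  next-∷ (_ ∷ mid) y = mid ++ [ y ] , refl

  head-∉ : ∀ {x : A} {xs} → Unique (x ∷ xs) → x ∉ xs
  head-∉ (x∉ ∷ _) = All¬⇒¬Any x∉

  unique-tail : ∀ {x : A} {xs} → Unique (x ∷ xs) → Unique xs
  unique-tail (_ ∷ u) = u

  unique-prefix : ∀ (xs : List A) {ys} → Unique (xs ++ ys) → Unique xs
  unique-prefix []       _          = []
  unique-prefix (x ∷ xs) (x∉ ∷ u)   = ++⁻ˡ xs x∉ ∷ unique-prefix xs u

  unique-disjoint : ∀ (xs : List A) {ys v} → Unique (xs ++ ys) → v ∈ xs → v ∉ ys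
  unique-disjoint (x ∷ xs) (x∉ ∷ _) (here refl) = All¬⇒¬Any (++⁻ʳ xs x∉)
  unique-disjoint (x ∷ xs) (_ ∷ u)  (there v∈)  = unique-disjoint xs u v∈

  unique-reverse : ∀ {xs : List A} → Unique xs → Unique (reverse xs)
  unique-reverse {xs} = Unique-resp-↭ (setoid A) (↭-sym (setoid A) (↭-reverse (setoid A) xs))

  module _ (_≟_ : DecidableEquality A) where
    open import Data.List.Membership.DecPropositional _≟_ using (_∈?_)

    first-in : ∀ (S L : List A) → Any (_∈ S) L →
               ∃ λ L₁ → ∃ λ z → ∃ λ L₂ → L ≡ L₁ ++ z ∷ L₂ × z ∈ S × All (_∉ S) L₁
    first-in S (w ∷ L) w∈ with w ∈? S
    ... | yes w∈S = [] , w , L , refl , w∈S , []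
    ... | no  w∉S with w∈
    ...   | here w∈S = ⊥-elim (w∉S w∈S)
    ...   | there p with first-in S L p
    ...     | L₁ , z , L₂ , refl , z∈S , L₁∉S = w ∷ L₁ , z , L₂ , refl , z∈S , w∉S ∷ L₁∉S

module Paths {n : ℕ} (G : Graph n) where

  Adj-sym : ∀ {u v} → Adj G u v → Adj G v u
  Adj-sym {u} {v} = subst T (adj-sym G u v)

  Adj-irrefl : ∀ {u v} → Adj G u v → u ≢ v
  Adj-irrefl {u} a refl = subst T (irrefl G u) a

  chain-split : ∀ L {z R} → AdjChain G (L ++ z ∷ R) → AdjChain G (L ++ [ z ]) × AdjChain G (z ∷ R)
  chain-split []          c       = tt , c
  chain-split (_ ∷ [])    (a , c) = (a , tt) , c
  chain-split (_ ∷ b ∷ L) (a , c) with chain-split (b ∷ L) c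
  ... | c₁ , c₂ = (a , c₁) , c₂

  chain-join : ∀ L {z R} → AdjChain G (L ++ [ z ]) → AdjChain G (z ∷ R) → AdjChain G (L ++ z ∷ R)
  chain-join []          _        c₂ = c₂
  chain-join (_ ∷ [])    (a , _)  c₂ = a , c₂
  chain-join (_ ∷ b ∷ L) (a , c₁) c₂ = a , chain-join (b ∷ L) c₁ c₂

  chain-reverse : ∀ L → AdjChain G L → AdjChain G (reverse L)
  chain-reverse []          _       = tt
  chain-reverse (_ ∷ [])    _       = tt
  chain-reverse (x ∷ y ∷ r) (a , c) =
    subst (AdjChain G) (sym (reverse-step x y r))
      (chain-join (reverse r) (subst (AdjChain G) (unfold-reverse y r) (chain-reverse (y ∷ r) c))
                  (Adj-sym a , tt))
    where
    reverse-step : ∀ x y r → reverse (x ∷ y ∷ r) ≡ reverse r ++ y ∷ [ x ]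
    reverse-step x y r = begin
      reverse (x ∷ y ∷ r)       ≡⟨ unfold-reverse x (y ∷ r) ⟩
      reverse (y ∷ r) ++ [ x ]  ≡⟨ cong (_++ [ x ]) (unfold-reverse y r) ⟩
      (reverse r ++ [ y ]) ++ [ x ] ≡⟨ ++-assoc (reverse r) [ y ] [ x ] ⟩
      reverse r ++ y ∷ [ x ]    ∎
      where open ≡-Reasoning

  edge-path : ∀ {u v} → Adj G u v → IsPath G u v []
  edge-path a = ((Adj-irrefl a ∷ []) ∷ [] ∷ []) , a , tt

  path-tail : ∀ {x y a} mid → IsPath G x y (a ∷ mid) → IsPath G a y mid
  path-tail _ (_ ∷ u , _ , c) = u , c

  path-first-edge : ∀ {x y} mid → IsPath G x y mid → Adj G x (next mid y)
  path-first-edge []      (_ , a , _) = a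
  path-first-edge (_ ∷ _) (_ , a , _) = a

  path-cons : ∀ {v x y} mid → Adj G v x → v ∉ x ∷ mid ++ [ y ] → IsPath G x y mid → IsPath G v y (x ∷ mid)
  path-cons _ a v∉ (u , c) = ¬Any⇒All¬ _ v∉ ∷ u , a , c

  path-prefix : ∀ {x y mid} C₁ {v C₂} → mid ++ [ y ] ≡ C₁ ++ v ∷ C₂ →
                IsPath G x y mid → IsPath G x v C₁
  path-prefix {x} C₁ {v} {C₂} eq (u , c)
    rewrite eq = unique-prefix (x ∷ C₁ ++ [ v ]) (subst Unique (sym (++-assoc (x ∷ C₁) [ v ] C₂)) u)
               , proj₁ (chain-split (x ∷ C₁) c)

  cycle-intro : ∀ {x} L → 2 ≤ length L → Unique (x ∷ L) → AdjChain G (x ∷ L ++ [ x ]) → IsCycle G (x ∷ L)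
  cycle-intro (_ ∷ _ ∷ _) _ u c = u , c
  cycle-intro (_ ∷ [])    (s≤s ())

  cycle-of-paths : ∀ {x z} A B → IsPath G x z A → IsPath G x z B →
                   (∀ {v} → v ∈ A → v ∉ B) → A ++ B ≢ [] → IsCycle G (x ∷ A ++ z ∷ reverse B)
  cycle-of-paths {x} {z} A B (uA , cA) (uB , cB) A∩B≡∅ nontrivial =
    cycle-intro (A ++ z ∷ reverse B) (long A B nontrivial) unique chain
    where
    open ≡-Reasoning
    long : ∀ A B → A ++ B ≢ [] → 2 ≤ length (A ++ z ∷ reverse B)
    long (_ ∷ A′) B′       _ = s≤s (≤-trans (s≤s z≤n) (length-++-≤ʳ (z ∷ reverse B′) {A′}))
    long []       (b ∷ B′) _ = s≤s (subst (1 ≤_) (sym (length-reverse (b ∷ B′))) (s≤s z≤n))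
    long []       []       ne = ⊥-elim (ne refl)

    unique : Unique (x ∷ A ++ z ∷ reverse B)
    unique = subst Unique (++-assoc (x ∷ A) [ z ] (reverse B))
               (Unique.++⁺ uA (unique-reverse (unique-prefix B (unique-tail uB))) disjoint)
      where
      disjoint : ∀ {v} → ¬ (v ∈ x ∷ A ++ [ z ] × v ∈ reverse B)
      disjoint (v∈ , v∈B) with ∈-++⁻ (x ∷ A) v∈ | reverse⁻ (setoid _) v∈B
      ... | inj₁ (here refl) | v∈B′ = head-∉ uB (∈-++⁺ˡ v∈B′)
      ... | inj₁ (there v∈A) | v∈B′ = A∩B≡∅ v∈A v∈B′
      ... | inj₂ (here refl) | v∈B′ = unique-disjoint (x ∷ B) uB (there v∈B′) (here refl)

    chain : AdjChain G (x ∷ (A ++ z ∷ reverse B) ++ [ x ])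
    chain = subst (λ L → AdjChain G (x ∷ L)) (sym (++-assoc A (z ∷ reverse B) [ x ]))
              (chain-join (x ∷ A) cA (subst (AdjChain G) back (chain-reverse (x ∷ B ++ [ z ]) cB)))
      where
      back : reverse (x ∷ B ++ [ z ]) ≡ z ∷ reverse B ++ [ x ]
      back = begin
        reverse ((x ∷ B) ++ [ z ])  ≡⟨ reverse-++ (x ∷ B) [ z ] ⟩
        z ∷ reverse (x ∷ B)         ≡⟨ cong (z ∷_) (unfold-reverse x B) ⟩
        z ∷ reverse B ++ [ x ]      ∎

  -- In an acyclic graph all paths from x to y leave x through the same neighbour:
  -- otherwise the first vertex of one path lying on the other closes a cycle.
  next-unique : Acyclic G → ∀ {x y} A B → IsPath G x y A → IsPath G x y B → next A y ≡ next B y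
  next-unique acyclic {x} {y} A B pA pB with next A y ≟ᶠ next B y
  ... | yes same = same
  ... | no differ with first-in _≟ᶠ_ (B ++ [ y ]) (A ++ [ y ]) (Any.++⁺ʳ A (here (∈-++⁺ʳ B (here refl))))
  ...   | A₁ , z , _ , eqA , z∈B , A₁∉B with ∈-∃++ z∈B
  ...     | B₁ , _ , eqB = ⊥-elim (acyclic _ (cycle-of-paths A₁ B₁
                                (path-prefix A₁ eqA pA) (path-prefix B₁ eqB pB)
                                A₁∩B₁≡∅ (nontrivial A₁ B₁ eqA eqB)))
    where
    A₁∩B₁≡∅ : ∀ {v} → v ∈ A₁ → v ∉ B₁
    A₁∩B₁≡∅ v∈A₁ v∈B₁ = All.lookup A₁∉B v∈A₁ (subst (_ ∈_) (sym eqB) (∈-++⁺ˡ v∈B₁))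
    -- if both interiors were empty, both paths would leave x through z
    nontrivial : ∀ A₁ B₁ {A₂ B₂} → A ++ [ y ] ≡ A₁ ++ z ∷ A₂ → B ++ [ y ] ≡ B₁ ++ z ∷ B₂ →
                 A₁ ++ B₁ ≢ []
    nontrivial [] [] eA eB _ = differ (trans (next-head A eA) (sym (next-head B eB)))
    nontrivial [] (_ ∷ _) _ _ ()
    nontrivial (_ ∷ _) _ _ _ ()

  path-through : Acyclic G → ∀ {x y z} → Adj G x y → Adj G y z → x ≢ z →
                 ∀ mid → IsPath G x z mid →
                 ∃ λ rest → mid ++ [ z ] ≡ y ∷ z ∷ rest
  path-through acyclic {x} {y} {z} xy yz x≢z mid P with next-unique acyclic mid [ y ] P x-y-z
    where
    x-y-z : IsPath G x z [ y ]
    x-y-z = ((Adj-irrefl xy ∷ x≢z ∷ []) ∷ (Adj-irrefl yz ∷ []) ∷ [] ∷ []) , xy , yz , tt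
  path-through acyclic {x} {y} {z} xy yz x≢z []         P | z≡y = ⊥-elim (Adj-irrefl yz (sym z≡y))
  path-through acyclic {x} {y} {z} xy yz x≢z (_ ∷ mid′) P | refl with next-∷ mid′ z
  ... | rest , eq =
    rest , cong (y ∷_) (trans eq (cong (_∷ rest) (next-unique acyclic mid′ [] (path-tail mid′ P) (edge-path yz))))

  LocallyProper : (Fin n → Fin n → ℕ) → Set
  LocallyProper c = ∀ {x y z} → Adj G x y → Adj G y z → x ≢ z → c x y ≢ c y z

  -- Along a path, consecutive edges share exactly one vertex.
  locallyProper⇒properChain : ∀ {c} → LocallyProper c → ∀ L → Unique L → AdjChain G L → ProperChain G c L
  locallyProper⇒properChain _     []          _ _ = tt
  locallyProper⇒properChain _     (_ ∷ [])    _ _ = tt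
  locallyProper⇒properChain _     (_ ∷ _ ∷ []) _ _ = tt
  locallyProper⇒properChain local (x ∷ y ∷ z ∷ r) u@(_ ∷ _ ∷ _) (xy , yz , c) =
    local xy yz (x≢z u) , locallyProper⇒properChain local (y ∷ z ∷ r) (unique-tail u) (yz , c)
    where
    x≢z : Unique (x ∷ y ∷ z ∷ r) → x ≢ z
    x≢z ((_ ∷ x≢z ∷ _) ∷ _) = x≢z

  locallyProper⇒properlyConnected : Connected G → ∀ C → LocallyProper (proj₁ C) → ProperlyConnected G C
  locallyProper⇒properlyConnected connected C local x y x≢y with connected x y x≢y
  ... | mid , (u , c) = mid , (u , c) , locallyProper⇒properChain local _ u c

  -- Conversely, in an acyclic graph a properly connected colouring is locally proper:
  -- the properly coloured x–z path must start with the edges xy and yz.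
  properlyConnected⇒locallyProper : Acyclic G → ∀ C → ProperlyConnected G C → LocallyProper (proj₁ C)
  properlyConnected⇒locallyProper acyclic (c , _) proper {x} {y} {z} xy yz x≢z with proper x z x≢z
  ... | mid , P , properChain with path-through acyclic xy yz x≢z mid P
  ...   | rest , eq = proj₁ (subst (λ L → ProperChain G c (x ∷ L)) eq properChain)


ind : Bool → ℕ
ind b = if b then 1 else 0

ind-T : ∀ {b} → T b → ind b ≡ 1
ind-T {true} _ = refl

ind-¬T : ∀ {b} → ¬ T b → ind b ≡ 0
ind-¬T {true}  ¬b = ⊥-elim (¬b _)
ind-¬T {false} _  = refl

T-ext : ∀ {a b} → (T a → T b) → (T b → T a) → a ≡ b
T-ext {true}  {true}  _ _ = refl
T-ext {true}  {false} f _ = ⊥-elim (f _)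
T-ext {false} {true}  _ g = ⊥-elim (g _)
T-ext {false} {false} _ _ = refl

ind-∨ : ∀ a b {c} → ¬ (T a × T b) → ind (c ∧ (a ∨ b)) ≡ ind (c ∧ a) + ind (c ∧ b)
ind-∨ _     _     {false} _ = refl
ind-∨ true  true  {true}  excl = ⊥-elim (excl (_ , _))
ind-∨ true  false {true}  _ = refl
ind-∨ false _     {true}  _ = refl

ind-split : ∀ a b c → ind (a ∧ b) ≡ ind (a ∧ b ∧ c) + ind (a ∧ b ∧ not c)
ind-split false _     _     = refl
ind-split true  false _     = refl
ind-split true  true  true  = refl
ind-split true  true  false = refl

ind-not : ∀ b → ind (not b) + ind b ≡ 1
ind-not true  = refl
ind-not false = refl

does-sound : ∀ {A : Set} (a? : Dec A) → T (does a?) → A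
does-sound (yes a) _ = a

does-complete : ∀ {A : Set} (a? : Dec A) → A → T (does a?)
does-complete (yes _) _ = _
does-complete (no ¬a) a = ¬a a

does-sound-¬ : ∀ {A : Set} (a? : Dec A) → T (not (does a?)) → ¬ A
does-sound-¬ (no ¬a) _ = ¬a

does-complete-¬ : ∀ {A : Set} (a? : Dec A) → ¬ A → T (not (does a?))
does-complete-¬ (yes a) ¬a = ¬a a
does-complete-¬ (no _)  _  = _

sum-tabulate : ∀ {A : Set} n (g : Fin n → A) (f : A → ℕ) → sum (map f (tabulate g)) ≡ ∑[ i < n ] f (g i)
sum-tabulate zero    g f = refl
sum-tabulate (suc n) g f = cong (f (g fzero) +_) (sum-tabulate n (g ∘ fsuc) f)

sum-allFin : ∀ {n} (f : Fin n → ℕ) → sum (map f (allFin n)) ≡ ∑[ i < n ] f i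
sum-allFin {n} f = sum-tabulate n (λ i → i) f

∑-zero : ∀ n → ∑[ i < n ] 0 ≡ 0
∑-zero = sum-replicate-zero

∑-one : ∀ n → ∑[ i < n ] 1 ≡ n
∑-one zero    = refl
∑-one (suc n) = cong suc (∑-one n)

∑-δ : ∀ {n} (a : Fin n) → ∑[ v < n ] ind (does (v ≟ᶠ a)) ≡ 1
∑-δ {suc n} fzero    = cong suc (∑-zero n)
∑-δ {suc n} (fsuc a) = ∑-δ a

module _ {n : ℕ} where

  count : (Fin n → Fin n → Bool) → ℕ
  count R = ∑[ u < n ] ∑[ v < n ] ind (R u v)

  count-cong : ∀ {R S} → (∀ u v → R u v ≡ S u v) → count R ≡ count S
  count-cong R≡S = sum-cong-≗ (λ u → sum-cong-≗ (λ v → cong ind (R≡S u v)))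

  count-+ : ∀ {R S S′} → (∀ u v → ind (R u v) ≡ ind (S u v) + ind (S′ u v)) →
            count R ≡ count S + count S′
  count-+ {R} {S} {S′} R≡S+S′ = begin
    count R
      ≡⟨ sum-cong-≗ (λ u → sum-cong-≗ (R≡S+S′ u)) ⟩
    ∑[ u < n ] ∑[ v < n ] (ind (S u v) + ind (S′ u v))
      ≡⟨ sum-cong-≗ (λ u → ∑-distrib-+ (λ v → ind (S u v)) (λ v → ind (S′ u v))) ⟩
    ∑[ u < n ] (∑[ v < n ] ind (S u v) + ∑[ v < n ] ind (S′ u v))
      ≡⟨ ∑-distrib-+ (λ u → ∑[ v < n ] ind (S u v)) (λ u → ∑[ v < n ] ind (S′ u v)) ⟩
    count S + count S′ ∎
    where open ≡-Reasoning

  count-transpose : ∀ R → count R ≡ count (λ u v → R v u)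
  count-transpose R = ∑-comm (λ u v → ind (R u v))

  before : Fin n → Fin n → Bool
  before u v = toℕ u <ᵇ toℕ v

  before-total : ∀ {u v} → u ≢ v → ind (before u v) + ind (before v u) ≡ 1
  before-total {u} {v} u≢v with <-cmp (toℕ u) (toℕ v)
  ... | tri< u<v _ _  = cong₂ _+_ (ind-T (<⇒<ᵇ u<v)) (ind-¬T (λ t → <-asym u<v (<ᵇ⇒< _ _ t)))
  ... | tri≈ _ eq _   = ⊥-elim (u≢v (toℕ-injective eq))
  ... | tri> _ _ v<u  = cong₂ _+_ (ind-¬T (λ t → <-asym v<u (<ᵇ⇒< _ _ t))) (ind-T (<⇒<ᵇ v<u))

  count-symmetric : ∀ R → (∀ u v → T (R u v) → u ≢ v) → (∀ u v → ¬ (T (R u v) × T (R v u))) →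
                    count (λ u v → before u v ∧ (R u v ∨ R v u)) ≡ count R
  count-symmetric R irrefl disjoint = begin
    count (λ u v → before u v ∧ (R u v ∨ R v u))
      ≡⟨ count-+ (λ u v → ind-∨ (R u v) (R v u) (disjoint u v)) ⟩
    count (λ u v → before u v ∧ R u v) + count (λ u v → before u v ∧ R v u)
      ≡⟨ cong (count (λ u v → before u v ∧ R u v) +_) (count-transpose (λ u v → before u v ∧ R v u)) ⟩
    count (λ u v → before u v ∧ R u v) + count (λ u v → before v u ∧ R u v)
      ≡⟨ sym (count-+ (λ u v → split (R u v) (irrefl u v))) ⟩
    count R ∎
    where
    open ≡-Reasoning
    split : ∀ {u v} b → (T b → u ≢ v) → ind b ≡ ind (before u v ∧ b) + ind (before v u ∧ b)
    split {u} {v} true  u≢v = sym (trans (cong₂ _+_ (cong ind (∧-identityʳ (before u v)))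
                                                   (cong ind (∧-identityʳ (before v u))))
                                         (before-total (u≢v _)))
    split {u} {v} false _   = sym (cong₂ _+_ (cong ind (∧-zeroʳ (before u v))) (cong ind (∧-zeroʳ (before v u))))

  count-graph : ∀ (P : Fin n → Bool) (f : Fin n → Fin n) →
                count (λ u v → P u ∧ does (v ≟ᶠ f u)) ≡ ∑[ u < n ] ind (P u)
  count-graph P f = sum-cong-≗ row
    where
    row : ∀ u → ∑[ v < n ] ind (P u ∧ does (v ≟ᶠ f u)) ≡ ind (P u)
    row u with P u
    ... | true  = ∑-δ (f u)
    ... | false = ∑-zero n

  Pair : Set
  Pair = Fin n × Fin n

  allPairs : List Pair
  allPairs = cartesianProduct (allFin n) (allFin n)

  _≟ₚ_ : DecidableEquality Pair
  _≟ₚ_ = ≡-dec _≟ᶠ_ _≟ᶠ_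

  open import Data.List.Membership.DecPropositional _≟ₚ_ using (_∈?_)

  does-pair : ∀ u v a b → does ((u , v) ≟ₚ (a , b)) ≡ does (u ≟ᶠ a) ∧ does (v ≟ᶠ b)
  does-pair u v a b = T-ext to from
    where
    to : T (does ((u , v) ≟ₚ (a , b))) → T (does (u ≟ᶠ a) ∧ does (v ≟ᶠ b))
    to t with does-sound ((u , v) ≟ₚ (a , b)) t
    ... | refl = Equivalence.from T-∧ (does-complete (u ≟ᶠ u) refl , does-complete (v ≟ᶠ v) refl)
    from : T (does (u ≟ᶠ a) ∧ does (v ≟ᶠ b)) → T (does ((u , v) ≟ₚ (a , b)))
    from t with Equivalence.to T-∧ t
    ... | ta , tb =
      does-complete ((u , v) ≟ₚ (a , b)) (cong₂ _,_ (does-sound (u ≟ᶠ a) ta) (does-sound (v ≟ᶠ b) tb))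

  count-point : ∀ q → count (λ u v → does ((u , v) ≟ₚ q)) ≡ 1
  count-point (a , b) = begin
    count (λ u v → does ((u , v) ≟ₚ (a , b)))
      ≡⟨ count-cong (λ u v → does-pair u v a b) ⟩
    count (λ u v → does (u ≟ᶠ a) ∧ does (v ≟ᶠ b))
      ≡⟨ count-graph (λ u → does (u ≟ᶠ a)) (λ _ → b) ⟩
    ∑[ u < n ] ind (does (u ≟ᶠ a))
      ≡⟨ ∑-δ a ⟩
    1 ∎
    where open ≡-Reasoning

  count-list : ∀ (L : List Pair) → Unique L → count (λ u v → does ((u , v) ∈? L)) ≡ length L
  count-list []      _          = begin
    count (λ _ _ → false)   ≡⟨ sum-cong-≗ {n} (λ _ → ∑-zero n) ⟩
    ∑[ u < n ] 0            ≡⟨ ∑-zero n ⟩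
    0                       ∎
    where open ≡-Reasoning
  count-list (q ∷ L) (q∉L ∷ uL) = begin
    count (λ u v → does ((u , v) ∈? q ∷ L))
      ≡⟨ count-+ (λ u v → ind-∨ (does ((u , v) ≟ₚ q)) (does ((u , v) ∈? L)) {true} (distinct u v)) ⟩
    count (λ u v → does ((u , v) ≟ₚ q)) + count (λ u v → does ((u , v) ∈? L))
      ≡⟨ cong₂ _+_ (count-point q) (count-list L uL) ⟩
    suc (length L) ∎
    where
    open ≡-Reasoning
    distinct : ∀ u v → ¬ (T (does ((u , v) ≟ₚ q)) × T (does ((u , v) ∈? L)))
    distinct u v (is-q , ∈L) with does-sound ((u , v) ≟ₚ q) is-q
    ... | refl = All¬⇒¬Any q∉L (does-sound ((u , v) ∈? L) ∈L)

  pairsWhere : (Fin n → Fin n → Bool) → List Pair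
  pairsWhere R = filter (λ p → T? (R (proj₁ p) (proj₂ p))) allPairs

  ∈-pairsWhere : ∀ {R p} → p ∈ pairsWhere R → T (R (proj₁ p) (proj₂ p))
  ∈-pairsWhere {R} p∈ = proj₂ (∈-filter⁻ (λ p → T? (R (proj₁ p) (proj₂ p))) {xs = allPairs} p∈)

  pairsWhere-unique : ∀ R → Unique (pairsWhere R)
  pairsWhere-unique R = Unique.filter⁺ _ (Unique.cartesianProduct⁺ (Unique.allFin⁺ n) (Unique.allFin⁺ n))

  count-pairsWhere : ∀ R → count R ≡ length (pairsWhere R)
  count-pairsWhere R = trans (count-cong member) (count-list (pairsWhere R) (pairsWhere-unique R))
    where
    member : ∀ u v → R u v ≡ does ((u , v) ∈? pairsWhere R)
    member u v = T-ext (λ Ruv → does-complete ((u , v) ∈? pairsWhere R)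
                                  (∈-filter⁺ _ (∈-cartesianProduct⁺ (∈-allFin u) (∈-allFin v)) Ruv))
                       (λ t → ∈-pairsWhere {R} (does-sound ((u , v) ∈? pairsWhere R) t))


module _ {n : ℕ} (G : Graph n) where

  edgeCount : ℕ
  edgeCount = count (λ u v → before u v ∧ adj G u v)

  keptEdge : Coloring G → Fin n → Fin n → Bool
  keptEdge (c , _) u v = before u v ∧ adj G u v ∧ (c u v ≡ᵇ 0)

  edgeCount-split : ∀ C → edgeCount ≡ count (keptEdge C) + recolored G C
  edgeCount-split (c , c-sym) = trans (count-+ (λ u v → ind-split (before u v) (adj G u v) (c u v ≡ᵇ 0)))
                                      (cong (count (keptEdge (c , c-sym)) +_) (sym recolored-count))
    where
    recolored-count : recolored G (c , c-sym) ≡ count (λ u v → before u v ∧ adj G u v ∧ not (c u v ≡ᵇ 0))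
    recolored-count = trans (sum-allFin {n} _)
      (sum-cong-≗ {n} (λ u → sum-allFin {n} (λ v → ind (before u v ∧ adj G u v ∧ not (c u v ≡ᵇ 0)))))

-- A tree rooted at r: each vertex v ≠ r has a parent, the neighbour through which every path
-- from v to r leaves v, and every edge is a parent edge for exactly one of its endpoints.
module Rooted {n : ℕ} (G : Graph n) (connected : Connected G) (acyclic : Acyclic G) (r : Fin n) where
  open Paths G
  open import Data.List.Membership.DecPropositional (_≟ᶠ_ {n}) using (_∈?_)

  -- The parent is read off a chosen path to the root; any other path gives the same vertex.
  parent : Fin n → Fin n
  parent v with v ≟ᶠ r
  ... | yes _   = r
  ... | no v≢r = next (proj₁ (connected v r v≢r)) r

  parent-next : ∀ {v} → v ≢ r → ∀ mid → IsPath G v r mid → parent v ≡ next mid r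
  parent-next {v} v≢r mid P with v ≟ᶠ r
  ... | yes v≡r  = ⊥-elim (v≢r v≡r)
  ... | no v≢r′ = next-unique acyclic _ _ (proj₂ (connected v r v≢r′)) P

  parent-adj : ∀ {v} → v ≢ r → Adj G v (parent v)
  parent-adj {v} v≢r with connected v r v≢r
  ... | mid , P = subst (Adj G v) (sym (parent-next v≢r mid P)) (path-first-edge mid P)

  -- Every edge at a non-root vertex u is its parent edge or the parent edge of the other end:
  -- follow the path from u to r; either it passes through v, or it extends to a path from v.
  edge-parent-nonroot : ∀ {u v} → u ≢ r → Adj G u v → parent u ≡ v ⊎ (v ≢ r × parent v ≡ u)
  edge-parent-nonroot {u} {v} u≢r uv with connected u r u≢r
  ... | mid , P with v ∈? mid ++ [ r ]
  ...   | yes v∈ with ∈-∃++ v∈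
  ...     | C₁ , _ , eq = inj₁ (begin
    parent u     ≡⟨ parent-next u≢r mid P ⟩
    next mid r   ≡⟨ next-prefix mid C₁ eq ⟩
    next C₁ v    ≡⟨ next-unique acyclic C₁ [] (path-prefix C₁ eq P) (edge-path uv) ⟩
    v            ∎)
    where
    open ≡-Reasoning
    next-prefix : ∀ mid C₁ {C₂} → mid ++ [ r ] ≡ C₁ ++ v ∷ C₂ → next mid r ≡ next C₁ v
    next-prefix mid []      eq = next-head mid eq
    next-prefix mid (_ ∷ _) eq = next-head mid eq
  edge-parent-nonroot {u} {v} u≢r uv | mid , P | no v∉ =
    inj₂ (v≢r , parent-next v≢r (u ∷ mid) (path-cons mid (Adj-sym uv) v∉u∷P P))
    where
    v≢r : v ≢ r
    v≢r refl = v∉ (∈-++⁺ʳ mid (here refl))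
    v∉u∷P : v ∉ u ∷ mid ++ [ r ]
    v∉u∷P (here v≡u) = Adj-irrefl uv (sym v≡u)
    v∉u∷P (there v∈) = v∉ v∈

  edge-parent : ∀ {u v} → Adj G u v → (u ≢ r × parent u ≡ v) ⊎ (v ≢ r × parent v ≡ u)
  edge-parent {u} {v} uv = by-root (u ≟ᶠ r)
    where
    by-root : Dec (u ≡ r) → (u ≢ r × parent u ≡ v) ⊎ (v ≢ r × parent v ≡ u)
    by-root (yes refl) = inj₂ (v≢u , parent-next v≢u [] (edge-path (Adj-sym uv)))
      where v≢u = Adj-irrefl (Adj-sym uv)
    by-root (no u≢r)   = map₁ (u≢r ,_) (edge-parent-nonroot u≢r uv)

  parent-not-mutual : ∀ {u v} → u ≢ r → parent u ≡ v → v ≢ r → parent v ≡ u → ⊥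
  parent-not-mutual {u} {v} u≢r pu≡v v≢r pv≡u with connected u r u≢r
  ... | [] , P = v≢r (trans (sym pu≡v) (parent-next u≢r [] P))
  ... | w ∷ mid , P with trans (sym (parent-next u≢r (w ∷ mid) P)) pu≡v
  ...   | refl with next-∷ mid r
  ...     | rest , eq = head-∉ (proj₁ P) (there (subst (u ∈_) (sym eq)
                          (here (trans (sym pv≡u) (parent-next v≢r mid (path-tail mid P))))))

  nonRoot : Fin n → Bool
  nonRoot u = not (does (u ≟ᶠ r))

  parentEdge : Fin n → Fin n → Bool
  parentEdge u v = nonRoot u ∧ does (v ≟ᶠ parent u)

  parentEdge-sound : ∀ u v → T (parentEdge u v) → u ≢ r × parent u ≡ v
  parentEdge-sound u v t with Equivalence.to T-∧ t
  ... | u≢r , pu≡v = does-sound-¬ (u ≟ᶠ r) u≢r , sym (does-sound (v ≟ᶠ parent u) pu≡v)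

  parentEdge-complete : ∀ {u v} → u ≢ r → parent u ≡ v → T (parentEdge u v)
  parentEdge-complete {u} {v} u≢r pu≡v =
    Equivalence.from T-∧ (does-complete-¬ (u ≟ᶠ r) u≢r , does-complete (v ≟ᶠ parent u) (sym pu≡v))

  parentEdge-adj : ∀ u v → T (parentEdge u v) → Adj G u v
  parentEdge-adj u v t with parentEdge-sound u v t
  ... | u≢r , pu≡v = subst (Adj G u) pu≡v (parent-adj u≢r)

  parentEdge-irrefl : ∀ u v → T (parentEdge u v) → u ≢ v
  parentEdge-irrefl u v = Adj-irrefl ∘ parentEdge-adj u v

  parentEdge-not-mutual : ∀ u v → ¬ (T (parentEdge u v) × T (parentEdge v u))
  parentEdge-not-mutual u v (t , t′) with parentEdge-sound u v t | parentEdge-sound v u t′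
  ... | u≢r , pu≡v | v≢r , pv≡u = parent-not-mutual u≢r pu≡v v≢r pv≡u

  adj≡parentEdge : ∀ u v → adj G u v ≡ parentEdge u v ∨ parentEdge v u
  adj≡parentEdge u v = T-ext to from
    where
    to : Adj G u v → T (parentEdge u v ∨ parentEdge v u)
    to uv with edge-parent uv
    ... | inj₁ (u≢r , pu≡v) = Equivalence.from T-∨ (inj₁ (parentEdge-complete u≢r pu≡v))
    ... | inj₂ (v≢r , pv≡u) = Equivalence.from T-∨ (inj₂ (parentEdge-complete v≢r pv≡u))
    from : T (parentEdge u v ∨ parentEdge v u) → Adj G u v
    from t with Equivalence.to T-∨ t
    ... | inj₁ t′ = parentEdge-adj u v t′
    ... | inj₂ t′ = Adj-sym (parentEdge-adj v u t′)

-- A tree has n − 1 edges: rooting it at any vertex r, its edges are exactly the pairs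
-- {u , parent u} for u ≠ r, each arising from one u only.
tree-edgeCount : ∀ {n} (G : Graph n) → IsTree G → Fin n → edgeCount G + 1 ≡ n
tree-edgeCount {n} G (connected , acyclic) r = begin
  edgeCount G + 1
    ≡⟨ cong (_+ 1) (count-cong (λ u v → cong (before u v ∧_) (adj≡parentEdge u v))) ⟩
  count (λ u v → before u v ∧ (parentEdge u v ∨ parentEdge v u)) + 1
    ≡⟨ cong (_+ 1) (count-symmetric parentEdge parentEdge-irrefl parentEdge-not-mutual) ⟩
  count parentEdge + 1
    ≡⟨ cong₂ _+_ (count-graph nonRoot parent) (sym (∑-δ r)) ⟩
  ∑[ u < n ] ind (nonRoot u) + ∑[ u < n ] ind (does (u ≟ᶠ r))
    ≡⟨ sym (∑-distrib-+ (λ u → ind (nonRoot u)) (λ u → ind (does (u ≟ᶠ r)))) ⟩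
  ∑[ u < n ] (ind (nonRoot u) + ind (does (u ≟ᶠ r)))
    ≡⟨ sum-cong-≗ {n} (λ u → ind-not (does (u ≟ᶠ r))) ⟩
  ∑[ u < n ] 1
    ≡⟨ ∑-one n ⟩
  n ∎
  where
  open ≡-Reasoning
  open Rooted G connected acyclic r

module Matchings {n : ℕ} (G : Graph n) where

  ends : Fin n × Fin n → List (Fin n)
  ends (a , b) = a ∷ b ∷ []

  ends-cases : ∀ {x a b} → x ∈ ends (a , b) → x ≡ a ⊎ x ≡ b
  ends-cases (here x≡a)         = inj₁ x≡a
  ends-cases (there (here x≡b)) = inj₂ x≡b

  three-in-pair : ∀ {e x y z} → x ∈ ends e → y ∈ ends e → z ∈ ends e →
                  x ≢ y → y ≢ z → x ≢ z → ⊥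
  three-in-pair x∈ y∈ z∈ x≢y y≢z x≢z with ends-cases x∈ | ends-cases y∈ | ends-cases z∈
  ... | inj₁ refl | inj₁ refl | _         = x≢y refl
  ... | inj₂ refl | inj₂ refl | _         = x≢y refl
  ... | inj₁ refl | inj₂ refl | inj₁ refl = x≢z refl
  ... | inj₁ refl | inj₂ refl | inj₂ refl = y≢z refl
  ... | inj₂ refl | inj₁ refl | inj₁ refl = y≢z refl
  ... | inj₂ refl | inj₁ refl | inj₂ refl = x≢z refl

  ∈-endpoints⁺ : ∀ {y e M} → y ∈ ends e → e ∈ M → y ∈ endpoints G M
  ∈-endpoints⁺ {M = (a , b) ∷ M} (here y≡a)         (here refl) = here y≡a
  ∈-endpoints⁺ {M = (a , b) ∷ M} (there (here y≡b)) (here refl) = there (here y≡b)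
  ∈-endpoints⁺ {M = (a , b) ∷ M} y∈e                (there e∈M) = there (there (∈-endpoints⁺ y∈e e∈M))

  ∈-endpoints⁻ : ∀ {y} M → y ∈ endpoints G M → ∃ λ e → e ∈ M × y ∈ ends e
  ∈-endpoints⁻ ((a , b) ∷ M) (here y≡a)          = (a , b) , here refl , here y≡a
  ∈-endpoints⁻ ((a , b) ∷ M) (there (here y≡b))  = (a , b) , here refl , there (here y≡b)
  ∈-endpoints⁻ ((a , b) ∷ M) (there (there y∈))  with ∈-endpoints⁻ M y∈
  ... | e , e∈M , y∈e = e , there e∈M , y∈e

  Nonadjacent : List (Fin n × Fin n) → Set
  Nonadjacent M = ∀ {e e′ y} → e ∈ M → e′ ∈ M → y ∈ ends e → y ∈ ends e′ → e ≡ e′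

  head-pair-fresh : ∀ {a b y E} → Unique (a ∷ b ∷ E) → y ∈ ends (a , b) → y ∉ E
  head-pair-fresh u       (here refl)         y∈E = head-∉ u (there y∈E)
  head-pair-fresh (_ ∷ u) (there (here refl)) y∈E = head-∉ u y∈E

  distinct-endpoints⇒nonadjacent : ∀ M → Unique (endpoints G M) → Nonadjacent M
  distinct-endpoints⇒nonadjacent ((a , b) ∷ M) _ (here refl) (here refl) _ _ = refl
  distinct-endpoints⇒nonadjacent ((a , b) ∷ M) u (here refl) (there e′∈M) y∈e y∈e′ =
    ⊥-elim (head-pair-fresh u y∈e (∈-endpoints⁺ y∈e′ e′∈M))
  distinct-endpoints⇒nonadjacent ((a , b) ∷ M) u (there e∈M) (here refl) y∈e y∈e′ =
    ⊥-elim (head-pair-fresh u y∈e′ (∈-endpoints⁺ y∈e e∈M))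
  distinct-endpoints⇒nonadjacent ((a , b) ∷ M) (_ ∷ _ ∷ u) (there e∈M) (there e′∈M) y∈e y∈e′ =
    distinct-endpoints⇒nonadjacent M u e∈M e′∈M y∈e y∈e′

  distinct-endpoints⇒unique : ∀ M → Unique (endpoints G M) → Unique M
  distinct-endpoints⇒unique []            _           = []
  distinct-endpoints⇒unique ((a , b) ∷ M) (u@(_ ∷ _ ∷ uM)) =
    ¬Any⇒All¬ M (λ e∈M → head-pair-fresh u (here refl) (∈-endpoints⁺ (here refl) e∈M))
    ∷ distinct-endpoints⇒unique M uM

  nonadjacent⇒distinct-endpoints : ∀ M → Unique M → (∀ {a b} → (a , b) ∈ M → a ≢ b) → Nonadjacent M →
                                   Unique (endpoints G M)
  nonadjacent⇒distinct-endpoints []            _          _     _ = []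
  nonadjacent⇒distinct-endpoints ((a , b) ∷ M) (e∉M ∷ uM) loopless nonadj =
    (loopless (here refl) ∷ fresh (here refl)) ∷ fresh (there (here refl))
    ∷ nonadjacent⇒distinct-endpoints M uM (loopless ∘ there) (λ e∈ e′∈ → nonadj (there e∈) (there e′∈))
    where
    fresh : ∀ {y} → y ∈ ends (a , b) → All (y ≢_) (endpoints G M)
    fresh y∈e = ¬Any⇒All¬ _ λ y∈M → let (e′ , e′∈M , y∈e′) = ∈-endpoints⁻ M y∈M in
                  All¬⇒¬Any e∉M (subst (_∈ M) (sym (nonadj (here refl) (there e′∈M) y∈e y∈e′)) e′∈M)

module MatchingColouring {n : ℕ} (G : Graph n) (M : List (Fin n × Fin n)) (matching : IsMatching G M) where
  open Paths G
  open Matchings G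
  open import Data.List.Membership.DecPropositional (_≟ₚ_ {n}) using (_∈?_)

  inM : Fin n → Fin n → Bool
  inM u v = does ((u , v) ∈? M) ∨ does ((v , u) ∈? M)

  colour : Fin n → Fin n → ℕ
  colour u v = if inM u v then 0 else suc (toℕ u + toℕ v)

  colouring : Coloring G
  colouring = colour , λ u v → cong₂ (λ b s → if b then 0 else suc s)
                                     (∨-comm (does ((u , v) ∈? M)) _) (+-comm (toℕ u) (toℕ v))

  nonadjacent : Nonadjacent M
  nonadjacent = distinct-endpoints⇒nonadjacent M (proj₂ matching)

  inM-sound : ∀ u v → T (inM u v) → ∃ λ e → e ∈ M × u ∈ ends e × v ∈ ends e
  inM-sound u v t with Equivalence.to T-∨ t
  ... | inj₁ uv∈M = (u , v) , does-sound ((u , v) ∈? M) uv∈M , here refl , there (here refl)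
  ... | inj₂ vu∈M = (v , u) , does-sound ((v , u) ∈? M) vu∈M , there (here refl) , here refl

  inM-adj : ∀ u v → T (inM u v) → Adj G u v
  inM-adj u v t with Equivalence.to T-∨ t
  ... | inj₁ uv∈M = All.lookup (proj₁ matching) (does-sound ((u , v) ∈? M) uv∈M)
  ... | inj₂ vu∈M = Adj-sym (All.lookup (proj₁ matching) (does-sound ((v , u) ∈? M) vu∈M))

  -- Two edges meeting in exactly one vertex: they cannot both lie in M; if neither does,
  -- their colours 1 + x + y and 1 + y + z differ since x ≠ z.
  locallyProper : LocallyProper colour
  locallyProper {x} {y} {z} xy yz x≢z with inM x y in exy | inM y z in eyz
  ... | true  | true  = λ _ → both-in-M (subst T (sym exy) _) (subst T (sym eyz) _)
    where
    -- the matching edges through xy and yz share y, hence coincide, but would have three ends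
    both-in-M : T (inM x y) → T (inM y z) → ⊥
    both-in-M txy tyz with inM-sound x y txy | inM-sound y z tyz
    ... | e , e∈M , x∈e , y∈e | e′ , e′∈M , y∈e′ , z∈e′ with nonadjacent e∈M e′∈M y∈e y∈e′
    ...   | refl = three-in-pair x∈e y∈e z∈e′ (Adj-irrefl xy) (Adj-irrefl yz) x≢z
  ... | true  | false = λ ()
  ... | false | true  = λ ()
  ... | false | false = λ same → x≢z (toℕ-injective
                          (+-cancelˡ-≡ (toℕ y) _ _ (trans (+-comm (toℕ y) (toℕ x)) (suc-injective same))))

  properlyConnected : Connected G → ProperlyConnected G colouring
  properlyConnected connected = locallyProper⇒properlyConnected connected colouring locallyProper

  kept≡M : count (keptEdge G colouring) ≡ length M
  kept≡M = begin
    count (keptEdge G colouring)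
      ≡⟨ count-cong (λ u v → cong (before u v ∧_) (T-ext (kept⇒inM u v) (inM⇒kept u v))) ⟩
    count (λ u v → before u v ∧ (does ((u , v) ∈? M) ∨ does ((v , u) ∈? M)))
      ≡⟨ count-symmetric (λ u v → does ((u , v) ∈? M)) loopless (λ u v → not-both u v) ⟩
    count (λ u v → does ((u , v) ∈? M))
      ≡⟨ count-list M (distinct-endpoints⇒unique M (proj₂ matching)) ⟩
    length M ∎
    where
    open ≡-Reasoning
    zero⇔inM : ∀ u v → (colour u v ≡ᵇ 0) ≡ inM u v
    zero⇔inM u v with inM u v
    ... | true  = refl
    ... | false = refl
    kept⇒inM : ∀ u v → T (adj G u v ∧ (colour u v ≡ᵇ 0)) → T (inM u v)
    kept⇒inM u v t = subst T (zero⇔inM u v) (proj₂ (Equivalence.to T-∧ t))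
    inM⇒kept : ∀ u v → T (inM u v) → T (adj G u v ∧ (colour u v ≡ᵇ 0))
    inM⇒kept u v t = Equivalence.from T-∧ (inM-adj u v t , subst T (sym (zero⇔inM u v)) t)
    loopless : ∀ u v → T (does ((u , v) ∈? M)) → u ≢ v
    loopless u v t = Adj-irrefl (All.lookup (proj₁ matching) (does-sound ((u , v) ∈? M) t))
    not-both : ∀ u v → ¬ (T (does ((u , v) ∈? M)) × T (does ((v , u) ∈? M)))
    not-both u v (uv , vu) with nonadjacent (does-sound ((u , v) ∈? M) uv) (does-sound ((v , u) ∈? M) vu)
                                           (here refl) (there (here refl))
    ... | refl = loopless u u uv refl

module KeptMatching {n : ℕ} (G : Graph n) (acyclic : Acyclic G) (C : Coloring G) (proper : ProperlyConnected G C) where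
  open Paths G
  open Matchings G

  private
    c = proj₁ C
    c-sym = proj₂ C

  -- The kept edges, listed in increasing order of their ends.
  kept : List (Fin n × Fin n)
  kept = pairsWhere (keptEdge G C)

  kept-edge : ∀ {a b} → (a , b) ∈ kept → toℕ a < toℕ b × Adj G a b × c a b ≡ 0
  kept-edge {a} {b} e∈ with Equivalence.to T-∧ (∈-pairsWhere {R = keptEdge G C} e∈)
  ... | a<b , t with Equivalence.to T-∧ t
  ...   | ab , c≡0 = <ᵇ⇒< _ _ a<b , ab , ≡ᵇ⇒≡ (c a b) 0 c≡0

  kept-at-most-one : ∀ {x y z} → Adj G x y → Adj G y z → c x y ≡ 0 → c y z ≡ 0 → x ≡ z
  kept-at-most-one {x} {y} {z} xy yz cxy cyz with x ≟ᶠ z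
  ... | yes x≡z = x≡z
  ... | no  x≢z = ⊥-elim (properlyConnected⇒locallyProper acyclic C proper xy yz x≢z (trans cxy (sym cyz)))

  -- Two kept edges with a common end are equal: if the common end is the smaller (or the larger)
  -- end of both, the other ends agree by kept-at-most-one; if it is the smaller end of one and
  -- the larger end of the other, kept-at-most-one would give a < b < a.
  kept-nonadjacent : Nonadjacent kept
  kept-nonadjacent {a , b} {a′ , b′} e∈ e′∈ y∈e y∈e′
    with kept-edge e∈ | kept-edge e′∈ | ends-cases y∈e | ends-cases y∈e′
  ... | _ , ab , cab | _ , a′b′ , ca′b′ | inj₁ refl | inj₁ refl =
    cong (a ,_) (kept-at-most-one (Adj-sym ab) a′b′ (trans (c-sym b a) cab) ca′b′)
  ... | _ , ab , cab | _ , a′b′ , ca′b′ | inj₂ refl | inj₂ refl =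
    cong (_, b) (kept-at-most-one ab (Adj-sym a′b′) cab (trans (c-sym b a′) ca′b′))
  ... | a<b , ab , cab | a′<b′ , a′b′ , ca′b′ | inj₁ refl | inj₂ refl
    with kept-at-most-one (Adj-sym ab) (Adj-sym a′b′) (trans (c-sym b a) cab) (trans (c-sym a a′) ca′b′)
  ...   | refl = ⊥-elim (<-asym a<b a′<b′)
  kept-nonadjacent {a , b} {a′ , b′} e∈ e′∈ y∈e y∈e′
    | a<b , ab , cab | a′<b′ , a′b′ , ca′b′ | inj₂ refl | inj₁ refl
    with kept-at-most-one ab a′b′ cab ca′b′
  ...   | refl = ⊥-elim (<-asym a<b a′<b′)

  kept-matching : IsMatching G kept
  kept-matching = All.tabulate (λ {e} e∈ → proj₁ (proj₂ (kept-edge e∈)))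
                , nonadjacent⇒distinct-endpoints kept (pairsWhere-unique (keptEdge G C))
                    (λ e∈ → Adj-irrefl (proj₁ (proj₂ (kept-edge e∈)))) kept-nonadjacent

matching⇒colouring : ∀ {n} (G : Graph n) → Connected G → ∀ M → IsMatching G M →
                      ∃ λ C → ProperlyConnected G C × length M + recolored G C ≡ edgeCount G
matching⇒colouring G connected M matching =
  colouring , properlyConnected connected ,
  trans (cong (_+ recolored G colouring) (sym kept≡M)) (sym (edgeCount-split G colouring))
  where open MatchingColouring G M matching

colouring⇒matching : ∀ {n} (G : Graph n) → Acyclic G → ∀ C → ProperlyConnected G C →
                      ∃ λ Z → IsMatching G Z × length Z + recolored G C ≡ edgeCount G
colouring⇒matching G acyclic C proper =
  kept , kept-matching ,
  trans (cong (_+ recolored G C) (sym (count-pairsWhere (keptEdge G C)))) (sym (edgeCount-split G C))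
  where open KeptMatching G acyclic C proper

complement : ∀ a {r e} → a + r ≡ e → r ≡ e ∸ a
complement a {r} refl = sym (m+n∸m≡n a r)

complement-≤ : ∀ {a r e k} → a ≤ k → a + r ≡ e → e ∸ k ≤ r
complement-≤ {a} {r} a≤k refl = ≤-trans (∸-monoʳ-≤ (a + r) a≤k) (≤-reflexive (m+n∸m≡n a r))

theorem11 : (n : ℕ) → 2 ≤ n → (T : Graph n) → IsTree T →
            (k : ℕ) → IsMaxMatchingSize T k → IsPcOpt T (n ∸ 1 ∸ k)
theorem11 (suc (suc m)) (s≤s (s≤s z≤n)) T tree@(connected , acyclic) k ((M , matching , refl) , maximum) =
  optimal , lower-bound
  where
  edges : edgeCount T ≡ suc m
  edges = suc-injective (trans (+-comm 1 (edgeCount T)) (tree-edgeCount T tree Fin.zero))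

  optimal : ∃ λ C → ProperlyConnected T C × recolored T C ≡ suc m ∸ length M
  optimal with matching⇒colouring T connected M matching
  ... | C , proper , split = C , proper , complement (length M) (trans split edges)

  lower-bound : ∀ C → ProperlyConnected T C → suc m ∸ length M ≤ recolored T C
  lower-bound C proper with colouring⇒matching T acyclic C proper
  ... | Z , matchingZ , split = complement-≤ (maximum Z matchingZ) (trans split edges)
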